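{- Let $G$ be a connected graph and let $X\subseteq V(G)$ be a twin cover of $G$ with $|X|=t$. Let $P$ be a shortest path in $G$ and let $C$ be a twin-clique. If at least one endpoint of $P$ lies outside $C$, then $P$ contains at most one vertex of $C$. Consequently, if the two endpoints of $P$ do not belong to the same twin-clique, then $P$ contains at most one vertex from each twin-clique, meets at most $t+1$ twin-cliques, and has length at most $2t$.
   Context: All graphs are finite, simple and undirected; paths are simple and the length of a path is its number of edges. Vertices $u\neq v$ are true twins if $N_G[u]=N_G[v]$; a twin edge is an edge whose endpoints are true twins; $X\subseteq V(G)$ is a twin cover of $G$ if every edge of $G-X$ is a twin edge. A twin-clique is a connected component of $G-X$. -}

module Defs where

open import Data.Nat using (ℕ; zero; suc; _≤_; _*_; _+_)
open import Data.Bool using (Bool; true; false; _∨_)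
open import Data.Fin using (Fin; zero; suc; inject₁; fromℕ; _≟_)
open import Data.Fin.Subset using (Subset; _∈_; _∉_; ∣_∣)
open import Data.Product using (Σ; ∃; ∃-syntax; _×_; _,_)
open import Data.Sum using (_⊎_)
open import Data.List using (List; length)
open import Data.List.Relation.Unary.All using (All)
open import Data.List.Relation.Unary.Unique.Propositional using (Unique)
open import Relation.Nullary using (¬_; does)
open import Relation.Binary.PropositionalEquality using (_≡_; _≢_)
open import Function.Bundles using (_⇔_)

record Graph (n : ℕ) : Set where
  field
    adj     : Fin n → Fin n → Bool
    symm    : ∀ u v → adj u v ≡ adj v u
    irrefl  : ∀ u → adj u u ≡ false
open Graph public

module _ {n : ℕ} (G : Graph n) where

  InClosedNbhd : Fin n → Fin n → Set
  InClosedNbhd u w = (w ≡ u) ⊎ (adj G u w ≡ true)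

  TrueTwins : Fin n → Fin n → Set
  TrueTwins u v = (u ≢ v) × (∀ w → InClosedNbhd u w ⇔ InClosedNbhd v w)

  IsTwinCover : Subset n → Set
  IsTwinCover X = ∀ u v → u ∉ X → v ∉ X → adj G u v ≡ true → TrueTwins u v

  data ReachOutside (X : Subset n) (u : Fin n) : Fin n → Set where
    here : u ∉ X → ReachOutside X u u
    step : ∀ {v w} → ReachOutside X u v → w ∉ X → adj G v w ≡ true →
           ReachOutside X u w

  IsTwinClique : Subset n → Subset n → Set
  IsTwinClique X C = Σ (Fin n) λ c → (c ∉ X) × (∀ v → (v ∈ C) ⇔ ReachOutside X c v)

  -- A path of length k (k edges): vertex sequence p 0, …, p k,
  -- consecutive vertices adjacent, all vertices distinct.
  IsPath : (k : ℕ) → (Fin (suc k) → Fin n) → Set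
  IsPath k p = (∀ (i : Fin k) → adj G (p (inject₁ i)) (p (suc i)) ≡ true)
             × (∀ i j → p i ≡ p j → i ≡ j)

  IsPathFromTo : Fin n → Fin n → (k : ℕ) → (Fin (suc k) → Fin n) → Set
  IsPathFromTo u v k p = IsPath k p × (p zero ≡ u) × (p (fromℕ k) ≡ v)

  IsShortestPath : (k : ℕ) → (Fin (suc k) → Fin n) → Set
  IsShortestPath k p = IsPath k p ×
    (∀ k' (q : Fin (suc k') → Fin n) → IsPathFromTo (p zero) (p (fromℕ k)) k' q → k ≤ k')

  Connected : Set
  Connected = ∀ u v → ∃[ k ] ∃[ p ] IsPathFromTo u v k p

  AtMostOneVertexIn : (k : ℕ) → (Fin (suc k) → Fin n) → Subset n → Set
  AtMostOneVertexIn k p C = ∀ i j → p i ∈ C → p j ∈ C → i ≡ j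

  Meets : (k : ℕ) → (Fin (suc k) → Fin n) → Subset n → Set
  Meets k p C = ∃[ i ] (p i ∈ C)

-- Vertices of one twin-clique are pairwise true twins, so two of them on a
-- shortest path are adjacent (else they form a chord) and hence consecutive;
-- if the path continues past either of them, the neighbour of one twin is
-- also a neighbour of the other, which is again a chord.  When the endpoints
-- lie in different twin-cliques, two consecutive vertices outside X would lie
-- in a common twin-clique, so the vertices outside X are separated by vertices
-- of X.  As the path visits at most t vertices of X, it has at most t + 1
-- vertices outside X, hence meets at most t + 1 twin-cliques and has at most
-- 2t + 1 vertices.
module Submission where

open import Defs
open import Data.Bool using (true)
open import Data.Empty using (⊥; ⊥-elim)
open import Data.Fin using (Fin; zero; suc; inject₁; fromℕ; fromℕ<; toℕ)
open import Data.Fin.Properties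
  using (toℕ-injective; toℕ-fromℕ<; toℕ-inject₁; toℕ-fromℕ; toℕ≤pred[n]; toℕ<n; suc-injective; 0≢1+n)
open import Data.Fin.Subset using (Subset; inside; outside; _∈_; _∉_; ∣_∣; ∁; _-_; _⊆_)
open import Data.Fin.Subset.Properties
  using (_∈?_; drop-there; ⊆-antisym; x∈p∧x≢y⇒x∈p-y; x∈p⇒∣p-x∣<∣p∣; x∉p⇒x∈∁p; ∣∁p∣≡n∸∣p∣; ∣p∣≤n)
open import Data.List using (List; []; _∷_; length)
open import Data.List.Relation.Unary.All as All using (All; []; _∷_)
open import Data.List.Relation.Unary.AllPairs using ([]; _∷_)
open import Data.List.Relation.Unary.Unique.Propositional using (Unique)
open import Data.Nat using (ℕ; zero; suc; _+_; _*_; _≤_; _<_; z≤n; s≤s; _≤?_)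
open import Data.Nat.Properties
  using (≤-refl; ≤-trans; <-trans; <-≤-trans; <⇒≤; <⇒≢; <⇒≱; n<1+n; <-cmp; m≤n⇒m≤1+n; m≤m+n;
         m≤n+m; m<n+m; +-monoʳ-≤; +-monoʳ-<; +-mono-≤; +-comm; +-suc; +-assoc; +-identityʳ;
         +-cancelˡ-≡; ≰⇒>; ≤-pred; module ≤-Reasoning; m⊓n≤n; m≤n⇒m⊓n≡m; m≤n⇒∃[o]m+o≡n; m+[n∸m]≡n)
open import Data.Product using (∃-syntax; _×_; _,_; proj₁; proj₂)
open import Data.Sum using (_⊎_; inj₁; inj₂)
open import Data.Vec using (_∷_; []; here; there; tabulate)
open import Data.Vec.Properties using (lookup∘tabulate; []=⇒lookup; lookup⇒[]=)
open import Function using (_∘_)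
open import Function.Bundles using (_⇔_; mk⇔; Equivalence)
open import Function.Definitions using (Injective)
open import Relation.Binary using (tri<; tri≈; tri>)
open import Relation.Binary.PropositionalEquality
open import Relation.Nullary using (¬_; Dec; yes; no; does)
open import Relation.Nullary.Decidable using (dec-true; ¬¬-excluded-middle)
open import Relation.Nullary.Negation using (¬¬-map)

open Equivalence using (to; from)

fromDecidable : ∀ {m} {P : Fin m → Set} → (∀ i → Dec (P i)) → Subset m
fromDecidable P? = tabulate (does ∘ P?)

∈-fromDecidable : ∀ {m} {P : Fin m → Set} (P? : ∀ i → Dec (P i)) {i} → i ∈ fromDecidable P? ⇔ P i
∈-fromDecidable P? {i} = mk⇔
  (λ i∈ → witness (P? i) (trans (sym (lookup∘tabulate (does ∘ P?) i)) ([]=⇒lookup i∈)))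
  (λ Pi → lookup⇒[]= i _ (trans (lookup∘tabulate (does ∘ P?) i) (dec-true (P? i) Pi)))
  where
  witness : ∀ {Q : Set} (Q? : Dec Q) → does Q? ≡ true → Q
  witness (yes q) _ = q
  witness (no _) ()

¬¬-decidable : ∀ {m} (P : Fin m → Set) → ¬ ¬ (∀ i → Dec (P i))
¬¬-decidable {zero} P k = k (λ ())
¬¬-decidable {suc m} P k = ¬¬-excluded-middle λ P0? →
  ¬¬-decidable (P ∘ suc) λ Ps? → k λ { zero → P0? ; (suc i) → Ps? i }

injective⇒∣p∣≤∣q∣ : ∀ {m n} {f : Fin m → Fin n} → Injective _≡_ _≡_ f →
                    ∀ p {q} → (∀ {i} → i ∈ p → f i ∈ q) → ∣ p ∣ ≤ ∣ q ∣
injective⇒∣p∣≤∣q∣ f-inj [] _ = z≤n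
injective⇒∣p∣≤∣q∣ f-inj (outside ∷ p) f[p]⊆q =
  injective⇒∣p∣≤∣q∣ (λ eq → suc-injective (f-inj eq)) p (f[p]⊆q ∘ there)
injective⇒∣p∣≤∣q∣ {f = f} f-inj (inside ∷ p) {q} f[p]⊆q =
  ≤-trans (s≤s (injective⇒∣p∣≤∣q∣ (λ eq → suc-injective (f-inj eq)) p f[p]⊆q-f0))
          (x∈p⇒∣p-x∣<∣p∣ (f[p]⊆q here))
  where
  f[p]⊆q-f0 : ∀ {i} → i ∈ p → f (suc i) ∈ q - f zero
  f[p]⊆q-f0 i∈p = x∈p∧x≢y⇒x∈p-y (f[p]⊆q (there i∈p)) (0≢1+n ∘ sym ∘ f-inj)

module _ {A : Set} {m} (Owns : A → Fin m → Set)
         (owner-unique : ∀ {x y i} → Owns x i → Owns y i → x ≡ y) where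

  length≤∣p∣ : ∀ {xs} p → Unique xs → All (λ x → ∃[ i ] i ∈ p × Owns x i) xs → length xs ≤ ∣ p ∣
  length≤∣p∣ p [] [] = z≤n
  length≤∣p∣ p (x≢xs ∷ xs!) ((i , i∈p , x-owns-i) ∷ owned) =
    ≤-trans (s≤s (length≤∣p∣ (p - i) xs! (All.zipWith owned-in-p-i (x≢xs , owned))))
            (x∈p⇒∣p-x∣<∣p∣ i∈p)
    where
    owned-in-p-i : ∀ {y} → _ ≢ y × ∃[ j ] j ∈ p × Owns y j → ∃[ j ] j ∈ p - i × Owns y j
    owned-in-p-i (x≢y , j , j∈p , y-owns-j) =
      j , x∈p∧x≢y⇒x∈p-y j∈p (λ { refl → x≢y (owner-unique x-owns-i y-owns-j) }) , y-owns-j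

∣p∣+∣∁p∣≡n : ∀ {n} (p : Subset n) → ∣ p ∣ + ∣ ∁ p ∣ ≡ n
∣p∣+∣∁p∣≡n p = trans (cong (∣ p ∣ +_) (∣∁p∣≡n∸∣p∣ p)) (m+[n∸m]≡n (∣p∣≤n p))

NoAdjacentGaps : ∀ {k} → Subset (suc k) → Set
NoAdjacentGaps {k} p = ∀ (i : Fin k) → inject₁ i ∉ p → suc i ∉ p → ⊥

noAdjacentGaps-tail : ∀ {k s} {p : Subset (suc k)} → NoAdjacentGaps (s ∷ p) → NoAdjacentGaps p
noAdjacentGaps-tail gapless i i∉p si∉p = gapless (suc i) (i∉p ∘ drop-there) (si∉p ∘ drop-there)

∣∁p∣≤1+∣p∣ : ∀ {k} (p : Subset (suc k)) → NoAdjacentGaps p → ∣ ∁ p ∣ ≤ suc ∣ p ∣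
∣∁p∣≤1+∣p∣ {zero} (inside ∷ []) _ = z≤n
∣∁p∣≤1+∣p∣ {zero} (outside ∷ []) _ = ≤-refl
∣∁p∣≤1+∣p∣ {suc k} (inside ∷ p) gapless = m≤n⇒m≤1+n (∣∁p∣≤1+∣p∣ p (noAdjacentGaps-tail gapless))
∣∁p∣≤1+∣p∣ {suc zero} (outside ∷ inside ∷ []) _ = s≤s z≤n
∣∁p∣≤1+∣p∣ {suc (suc k)} (outside ∷ inside ∷ p) gapless =
  s≤s (∣∁p∣≤1+∣p∣ p (noAdjacentGaps-tail (noAdjacentGaps-tail gapless)))
∣∁p∣≤1+∣p∣ {suc k} (outside ∷ outside ∷ p) gapless = ⊥-elim (gapless zero (λ ()) λ { (there ()) })

inject₁≢suc : ∀ {k} (i : Fin k) → inject₁ i ≢ suc i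
inject₁≢suc zero ()
inject₁≢suc (suc i) eq = inject₁≢suc i (suc-injective eq)

-- p ∘ clamp k views a path p : Fin (suc k) → Fin n as an ℕ-indexed
-- sequence; its values beyond k are junk and never used.
clamp : ∀ k → ℕ → Fin (suc k)
clamp k m = fromℕ< (s≤s (m⊓n≤n m k))

toℕ-clamp : ∀ {k m} → m ≤ k → toℕ (clamp k m) ≡ m
toℕ-clamp m≤k = trans (toℕ-fromℕ< _) (m≤n⇒m⊓n≡m m≤k)

clamp-≡ : ∀ {k m} {i : Fin (suc k)} → toℕ i ≡ m → clamp k m ≡ i
clamp-≡ {i = i} refl = toℕ-injective (toℕ-clamp (toℕ≤pred[n] i))

skip : ℕ → ℕ → ℕ → ℕ
skip a d m with m ≤? a
... | yes _ = m
... | no _  = suc d + m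

skip-≤ : ∀ {a d m} → m ≤ a → skip a d m ≡ m
skip-≤ {a} {d} {m} m≤a with m ≤? a
... | yes _ = refl
... | no m≰a = ⊥-elim (m≰a m≤a)

skip-> : ∀ {a d m} → a < m → skip a d m ≡ suc d + m
skip-> {a} {d} {m} a<m with m ≤? a
... | yes m≤a = ⊥-elim (<⇒≱ a<m m≤a)
... | no _ = refl

skip-injective : ∀ {a d} → Injective _≡_ _≡_ (skip a d)
skip-injective {a} {d} {m} {m'} eq with m ≤? a | m' ≤? a
... | yes _ | yes _ = eq
... | no _ | no _ = +-cancelˡ-≡ (suc d) m m' eq
... | yes m≤a | no m'≰a = ⊥-elim (<⇒≢ (≤-trans (s≤s m≤a) (≤-trans (≰⇒> m'≰a) (m≤n+m m' (suc d)))) eq)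
... | no m≰a | yes m'≤a = ⊥-elim (<⇒≢ (≤-trans (s≤s m'≤a) (≤-trans (≰⇒> m≰a) (m≤n+m m (suc d)))) (sym eq))

chord-decomposition : ∀ {a b k} → suc a < b → b ≤ k →
  ∃[ d ] ∃[ k' ] b ≡ suc d + suc a × k ≡ suc d + k' × a < k'
chord-decomposition {a} a+1<b b≤k with m≤n⇒∃[o]m+o≡n a+1<b | m≤n⇒∃[o]m+o≡n b≤k
... | d , refl | e , refl =
  d , suc a + e , b≡ , trans (cong (_+ e) b≡) (+-assoc (suc d) (suc a) e) , s≤s (m≤m+n a e)
  where
  b≡ : suc (suc a) + d ≡ suc d + suc a
  b≡ = trans (+-comm (suc (suc a)) d) (+-suc d (suc a))

module _ {A : Set} (_~_ : A → A → Set) where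

  record IsPathℕ (k : ℕ) (P : ℕ → A) : Set where
    field
      adjacent  : ∀ {m} → m < k → P m ~ P (suc m)
      injective : ∀ {m m'} → m ≤ k → m' ≤ k → P m ≡ P m' → m ≡ m'

  splice : ∀ {a d k P} → IsPathℕ (suc d + k) P → a < k → P a ~ P (suc d + suc a) →
           IsPathℕ k (P ∘ skip a d)
  splice {a} {d} {k} {P} path a<k chord = record { adjacent = adjacent′ ; injective = injective′ }
    where
    open IsPathℕ path
    skip-bounded : ∀ {m} → m ≤ k → skip a d m ≤ suc d + k
    skip-bounded {m} m≤k with m ≤? a
    ... | yes _ = ≤-trans m≤k (m≤n+m k (suc d))
    ... | no _  = +-monoʳ-≤ (suc d) m≤k
    adjacent′ : ∀ {m} → m < k → P (skip a d m) ~ P (skip a d (suc m))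
    adjacent′ {m} m<k with <-cmp m a
    ... | tri< m<a _ _ rewrite skip-≤ {a} {d} (<⇒≤ m<a) | skip-≤ {a} {d} m<a =
      adjacent (<-≤-trans m<k (m≤n+m k (suc d)))
    ... | tri≈ _ refl _ rewrite skip-≤ {a} {d} (≤-refl {a}) | skip-> {a} {d} (n<1+n a) = chord
    ... | tri> _ _ a<m rewrite skip-> {a} {d} a<m | skip-> {a} {d} (<-trans a<m (n<1+n m)) =
      subst (λ x → P (suc d + m) ~ P x) (sym (+-suc (suc d) m)) (adjacent (+-monoʳ-< (suc d) m<k))
    injective′ : ∀ {m m'} → m ≤ k → m' ≤ k → P (skip a d m) ≡ P (skip a d m') → m ≡ m'
    injective′ m≤k m'≤k eq = skip-injective (injective (skip-bounded m≤k) (skip-bounded m'≤k) eq)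

  shortcut : ∀ {a b k P} → IsPathℕ k P → suc a < b → b ≤ k → P a ~ P b →
             ∃[ k' ] k' < k × ∃[ Q ] IsPathℕ k' Q × Q 0 ≡ P 0 × Q k' ≡ P k
  shortcut {a} {P = P} path a+1<b b≤k chord with chord-decomposition a+1<b b≤k
  ... | d , k' , refl , refl , a<k' =
    k' , m<n+m k' (s≤s z≤n) , P ∘ skip a d , splice path a<k' chord ,
    cong P (skip-≤ {a} {d} z≤n) , cong P (skip-> a<k')

module _ {n : ℕ} (G : Graph n) where

  Adj : Fin n → Fin n → Set
  Adj u v = adj G u v ≡ true

  adj-sym : ∀ {u v} → Adj u v → Adj v u
  adj-sym {u} {v} e = trans (symm G v u) e

  IsPath⇒IsPathℕ : ∀ {k p} → IsPath G k p → IsPathℕ Adj k (p ∘ clamp k)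
  IsPath⇒IsPathℕ {k} {p} (steps , inj) = record { adjacent = adjacent ; injective = injective }
    where
    adjacent : ∀ {m} → m < k → Adj (p (clamp k m)) (p (clamp k (suc m)))
    adjacent m<k = subst₂ Adj
      (cong p (sym (clamp-≡ (trans (toℕ-inject₁ i) (toℕ-fromℕ< m<k)))))
      (cong p (sym (clamp-≡ (cong suc (toℕ-fromℕ< m<k)))))
      (steps i)
      where i = fromℕ< m<k
    injective : ∀ {m m'} → m ≤ k → m' ≤ k → p (clamp k m) ≡ p (clamp k m') → m ≡ m'
    injective m≤k m'≤k eq =
      trans (sym (toℕ-clamp m≤k)) (trans (cong toℕ (inj _ _ eq)) (toℕ-clamp m'≤k))

  IsPathℕ⇒IsPath : ∀ {k P} → IsPathℕ Adj k P → IsPath G k (P ∘ toℕ)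
  IsPathℕ⇒IsPath {P = P} path =
    (λ i → subst (λ m → Adj (P m) (P (suc (toℕ i)))) (sym (toℕ-inject₁ i)) (adjacent (toℕ<n i))) ,
    (λ i j eq → toℕ-injective (injective (toℕ≤pred[n] i) (toℕ≤pred[n] j) eq))
    where open IsPathℕ path

  NoChord : ℕ → (ℕ → Fin n) → Set
  NoChord k P = ∀ {a b} → suc a < b → b ≤ k → ¬ Adj (P a) (P b)

  shortest⇒noChord : ∀ {k p} → IsShortestPath G k p → NoChord k (p ∘ clamp k)
  shortest⇒noChord {k} {p} (path , shortest) a+1<b b≤k chord
    with shortcut Adj (IsPath⇒IsPathℕ path) a+1<b b≤k chord
  ... | k' , k'<k , Q , Q-path , Q0≡ , Qk'≡ =
    <⇒≱ k'<k (shortest k' (Q ∘ toℕ) (IsPathℕ⇒IsPath Q-path , starts , ends))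
    where
    starts : Q 0 ≡ p zero
    starts = trans Q0≡ (cong p (clamp-≡ refl))
    ends : Q (toℕ (fromℕ k')) ≡ p (fromℕ k)
    ends = trans (cong Q (toℕ-fromℕ k')) (trans Qk'≡ (cong p (clamp-≡ (toℕ-fromℕ k))))

  SameClosedNbhd : Fin n → Fin n → Set
  SameClosedNbhd u v = ∀ w → InClosedNbhd G u w ⇔ InClosedNbhd G v w

  sameClosedNbhd-refl : ∀ {u} → SameClosedNbhd u u
  sameClosedNbhd-refl w = mk⇔ (λ x → x) (λ x → x)

  sameClosedNbhd-sym : ∀ {u v} → SameClosedNbhd u v → SameClosedNbhd v u
  sameClosedNbhd-sym u≈v w = mk⇔ (from (u≈v w)) (to (u≈v w))

  sameClosedNbhd-trans : ∀ {u v x} → SameClosedNbhd u v → SameClosedNbhd v x → SameClosedNbhd u x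
  sameClosedNbhd-trans u≈v v≈x w = mk⇔ (to (v≈x w) ∘ to (u≈v w)) (from (u≈v w) ∘ from (v≈x w))

  sameClosedNbhd⇒adj : ∀ {u v} → SameClosedNbhd u v → u ≢ v → Adj u v
  sameClosedNbhd⇒adj {u} u≈v u≢v with to (u≈v u) (inj₁ refl)
  ... | inj₁ u≡v = ⊥-elim (u≢v u≡v)
  ... | inj₂ v~u = adj-sym v~u

  sameClosedNbhd-adj : ∀ {u v w} → SameClosedNbhd u v → Adj u w → w ≢ v → Adj v w
  sameClosedNbhd-adj {w = w} u≈v u~w w≢v with to (u≈v w) (inj₂ u~w)
  ... | inj₁ w≡v = ⊥-elim (w≢v w≡v)
  ... | inj₂ v~w = v~w

  module _ {k P} (path : IsPathℕ Adj k P) (noChord : NoChord k P) {S : Fin n → Set}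
           (twins : ∀ {u v} → S u → S v → SameClosedNbhd u v) where
    open IsPathℕ path

    distinct : ∀ {m m'} → m < m' → m' ≤ k → P m ≢ P m'
    distinct m<m' m'≤k eq = <⇒≢ m<m' (injective (<⇒≤ (<-≤-trans m<m' m'≤k)) m'≤k eq)

    twins-consecutive : ∀ {m m'} → m < m' → m' ≤ k → S (P m) → S (P m') → m' ≡ suc m
    twins-consecutive {m} {m'} m<m' m'≤k s s' with <-cmp (suc m) m'
    ... | tri< m+1<m' _ _ = ⊥-elim (noChord m+1<m' m'≤k
                                      (sameClosedNbhd⇒adj (twins s s') (distinct m<m' m'≤k)))
    ... | tri≈ _ m+1≡m' _ = sym m+1≡m'
    ... | tri> _ _ m'<m+1 = ⊥-elim (<⇒≱ m'<m+1 m<m')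

    twins-no-predecessor : ∀ {a} → suc (suc a) ≤ k → S (P (suc a)) → S (P (suc (suc a))) → ⊥
    twins-no-predecessor {a} a+2≤k s s' = noChord ≤-refl a+2≤k (adj-sym
      (sameClosedNbhd-adj (twins s s') (adj-sym (adjacent a<k))
        (distinct (<-trans (n<1+n a) (n<1+n (suc a))) a+2≤k)))
      where a<k = <-trans (n<1+n a) a+2≤k

    twins-no-successor : ∀ {m} → suc (suc m) ≤ k → S (P m) → S (P (suc m)) → ⊥
    twins-no-successor {m} m+2≤k s s' = noChord ≤-refl m+2≤k
      (sameClosedNbhd-adj (twins s' s) (adjacent m+2≤k)
        (distinct (<-trans (n<1+n m) (n<1+n (suc m))) m+2≤k ∘ sym))

    twins-ordered-absurd : ∀ {m m'} → m < m' → m' ≤ k → ¬ S (P 0) ⊎ ¬ S (P k) →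
                           S (P m) → S (P m') → ⊥
    twins-ordered-absurd {m} m<m' m'≤k ends s s' with twins-consecutive m<m' m'≤k s s'
    twins-ordered-absurd {zero} _ _ (inj₁ ¬s0) s _ | refl = ¬s0 s
    twins-ordered-absurd {suc a} _ m'≤k (inj₁ _) s s' | refl = twins-no-predecessor m'≤k s s'
    twins-ordered-absurd {m} _ m'≤k (inj₂ ¬sk) s s' | refl with <-cmp (suc m) k
    ... | tri< m+1<k _ _ = twins-no-successor m+1<k s s'
    ... | tri≈ _ refl _  = ¬sk s'
    ... | tri> _ _ k<m+1 = <⇒≱ k<m+1 m'≤k

    twins-atMostOne : ∀ {m m'} → ¬ S (P 0) ⊎ ¬ S (P k) → m ≤ k → m' ≤ k →
                      S (P m) → S (P m') → m ≡ m'
    twins-atMostOne {m} {m'} ends m≤k m'≤k s s' with <-cmp m m'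
    ... | tri< m<m' _ _ = ⊥-elim (twins-ordered-absurd m<m' m'≤k ends s s')
    ... | tri≈ _ m≡m' _ = m≡m'
    ... | tri> _ _ m'<m = ⊥-elim (twins-ordered-absurd m'<m m≤k ends s' s)

  module _ {X : Subset n} where

    reach-∉ : ∀ {u v} → ReachOutside G X u v → v ∉ X
    reach-∉ (here u∉X) = u∉X
    reach-∉ (step _ w∉X _) = w∉X

    reach-trans : ∀ {u v w} → ReachOutside G X u v → ReachOutside G X v w → ReachOutside G X u w
    reach-trans r (here _) = r
    reach-trans r (step r' w∉X e) = step (reach-trans r r') w∉X e

    reach-sym : ∀ {u v} → ReachOutside G X u v → ReachOutside G X v u
    reach-sym (here u∉X) = here u∉X
    reach-sym (step r w∉X e) = reach-trans (step (here w∉X) (reach-∉ r) (adj-sym e)) (reach-sym r)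

    twinClique-∉ : ∀ {C v} → IsTwinClique G X C → v ∈ C → v ∉ X
    twinClique-∉ (_ , _ , C⇔) v∈C = reach-∉ (to (C⇔ _) v∈C)

    twinClique-⊆ : ∀ {C D w} → IsTwinClique G X C → IsTwinClique G X D → w ∈ C → w ∈ D → C ⊆ D
    twinClique-⊆ (_ , _ , C⇔) (_ , _ , D⇔) w∈C w∈D v∈C =
      from (D⇔ _) (reach-trans (to (D⇔ _) w∈D) (reach-trans (reach-sym (to (C⇔ _) w∈C)) (to (C⇔ _) v∈C)))

    twinClique-≡ : ∀ {C D w} → IsTwinClique G X C → IsTwinClique G X D → w ∈ C → w ∈ D → C ≡ D
    twinClique-≡ clC clD w∈C w∈D = ⊆-antisym (twinClique-⊆ clC clD w∈C w∈D) (twinClique-⊆ clD clC w∈D w∈C)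

    -- Reachability in G - X is not known to be decidable, so the vertex set
    -- of a component only exists under double negation.
    ¬¬-componentOf : ∀ c → ¬ ¬ (∃[ C ] (∀ v → v ∈ C ⇔ ReachOutside G X c v))
    ¬¬-componentOf c = ¬¬-map (λ R? → fromDecidable R? , λ v → ∈-fromDecidable R?)
                              (¬¬-decidable (ReachOutside G X c))

    module _ (cover : IsTwinCover G X) where

      reach⇒sameClosedNbhd : ∀ {u v} → ReachOutside G X u v → SameClosedNbhd u v
      reach⇒sameClosedNbhd (here _) = sameClosedNbhd-refl
      reach⇒sameClosedNbhd (step {v} {w} r w∉X e) =
        sameClosedNbhd-trans (reach⇒sameClosedNbhd r) (proj₂ (cover v w (reach-∉ r) w∉X e))

      twinClique⇒sameClosedNbhd : ∀ {C u v} → IsTwinClique G X C → u ∈ C → v ∈ C → SameClosedNbhd u v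
      twinClique⇒sameClosedNbhd (_ , _ , C⇔) u∈C v∈C = sameClosedNbhd-trans
        (sameClosedNbhd-sym (reach⇒sameClosedNbhd (to (C⇔ _) u∈C))) (reach⇒sameClosedNbhd (to (C⇔ _) v∈C))

      module OnShortestPath {k p} (sp : IsShortestPath G k p) where

        shortestPath-atMostOne : ∀ {C} → IsTwinClique G X C → p zero ∉ C ⊎ p (fromℕ k) ∉ C →
                                 AtMostOneVertexIn G k p C
        shortestPath-atMostOne {C} cl ends i j i∈C j∈C = toℕ-injective
          (twins-atMostOne (IsPath⇒IsPathℕ (proj₁ sp)) (shortest⇒noChord sp)
            (twinClique⇒sameClosedNbhd cl) (on-path-ends ends) (toℕ≤pred[n] i) (toℕ≤pred[n] j) (on-path i∈C) (on-path j∈C))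
          where
          on-path : ∀ {i} → p i ∈ C → p (clamp k (toℕ i)) ∈ C
          on-path {i} = subst (_∈ C) (cong p (sym (clamp-≡ refl)))
          on-path-ends : p zero ∉ C ⊎ p (fromℕ k) ∉ C → p (clamp k 0) ∉ C ⊎ p (clamp k k) ∉ C
          on-path-ends (inj₁ p0∉C) = inj₁ (p0∉C ∘ subst (_∈ C) (cong p (clamp-≡ refl)))
          on-path-ends (inj₂ pk∉C) = inj₂ (pk∉C ∘ subst (_∈ C) (cong p (clamp-≡ (toℕ-fromℕ k))))

        positionsIn : Subset n → Subset (suc k)
        positionsIn Y = fromDecidable (λ i → p i ∈? Y)

        ∈-positionsIn : ∀ {Y i} → i ∈ positionsIn Y ⇔ p i ∈ Y
        ∈-positionsIn {Y} = ∈-fromDecidable (λ i → p i ∈? Y)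

        endsApart⇒atMostOne : ¬ (∃[ C ] (IsTwinClique G X C × p zero ∈ C × p (fromℕ k) ∈ C)) →
                              ∀ {C} → IsTwinClique G X C → AtMostOneVertexIn G k p C
        endsApart⇒atMostOne ends-apart {C} cl with p zero ∈? C | p (fromℕ k) ∈? C
        ... | no p0∉C   | _         = shortestPath-atMostOne cl (inj₁ p0∉C)
        ... | yes _     | no pk∉C   = shortestPath-atMostOne cl (inj₂ pk∉C)
        ... | yes p0∈C  | yes pk∈C  = ⊥-elim (ends-apart (C , cl , p0∈C , pk∈C))

        endsApart⇒noAdjacentGaps : ¬ (∃[ C ] (IsTwinClique G X C × p zero ∈ C × p (fromℕ k) ∈ C)) →
                                   NoAdjacentGaps (positionsIn X)
        endsApart⇒noAdjacentGaps ends-apart i i∉ si∉ =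
          ¬¬-componentOf (p (inject₁ i)) λ (C , C⇔) →
            inject₁≢suc i (endsApart⇒atMostOne ends-apart (_ , p-i∉X , C⇔) _ _
              (from (C⇔ _) (here p-i∉X)) (from (C⇔ _) (step (here p-i∉X) p-si∉X (proj₁ (proj₁ sp) i))))
          where
          p-i∉X : p (inject₁ i) ∉ X
          p-i∉X = i∉ ∘ from ∈-positionsIn
          p-si∉X : p (suc i) ∉ X
          p-si∉X = si∉ ∘ from ∈-positionsIn

        ∣positionsIn-X∣≤∣X∣ : ∣ positionsIn X ∣ ≤ ∣ X ∣
        ∣positionsIn-X∣≤∣X∣ = injective⇒∣p∣≤∣q∣ (proj₂ (proj₁ sp) _ _) (positionsIn X) (to ∈-positionsIn)

        ∣positionsOutside-X∣≤1+∣X∣ : NoAdjacentGaps (positionsIn X) → ∣ ∁ (positionsIn X) ∣ ≤ suc ∣ X ∣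
        ∣positionsOutside-X∣≤1+∣X∣ gaps = ≤-trans (∣∁p∣≤1+∣p∣ (positionsIn X) gaps) (s≤s ∣positionsIn-X∣≤∣X∣)

        length≤2*∣X∣ : NoAdjacentGaps (positionsIn X) → k ≤ 2 * ∣ X ∣
        length≤2*∣X∣ gaps = ≤-pred (begin
          suc k                                   ≡⟨ sym (∣p∣+∣∁p∣≡n (positionsIn X)) ⟩
          ∣ positionsIn X ∣ + ∣ ∁ (positionsIn X) ∣ ≤⟨ +-mono-≤ ∣positionsIn-X∣≤∣X∣ (∣positionsOutside-X∣≤1+∣X∣ gaps) ⟩
          ∣ X ∣ + suc ∣ X ∣                       ≡⟨ +-suc ∣ X ∣ ∣ X ∣ ⟩
          suc (∣ X ∣ + ∣ X ∣)                     ≡⟨ cong (λ x → suc (∣ X ∣ + x)) (sym (+-identityʳ ∣ X ∣)) ⟩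
          suc (2 * ∣ X ∣)                         ∎)
          where open ≤-Reasoning

        twinCliquesMet≤∣positionsOutside-X∣ : ∀ {Cs} → Unique Cs →
          All (λ C → IsTwinClique G X C × Meets G k p C) Cs → length Cs ≤ ∣ ∁ (positionsIn X) ∣
        twinCliquesMet≤∣positionsOutside-X∣ uniq meets =
          length≤∣p∣ Owns (λ (clC , i∈C) (clD , i∈D) → twinClique-≡ clC clD i∈C i∈D) _ uniq (All.map owns meets)
          where
          Owns : Subset n → Fin (suc k) → Set
          Owns C i = IsTwinClique G X C × p i ∈ C
          owns : ∀ {C} → IsTwinClique G X C × Meets G k p C → ∃[ i ] i ∈ ∁ (positionsIn X) × Owns C i
          owns (cl , i , pi∈C) = i , x∉p⇒x∈∁p (twinClique-∉ cl pi∈C ∘ to ∈-positionsIn) , cl , pi∈C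

lemma2 : ∀ {n} (G : Graph n) → Connected G →
    (X : Subset n) → IsTwinCover G X → (t : ℕ) → ∣ X ∣ ≡ t →
    (k : ℕ) (p : Fin (suc k) → Fin n) → IsShortestPath G k p →
    ((C : Subset n) → IsTwinClique G X C →
      (p zero ∉ C ⊎ p (fromℕ k) ∉ C) → AtMostOneVertexIn G k p C)
    × (¬ (∃[ C ] (IsTwinClique G X C × p zero ∈ C × p (fromℕ k) ∈ C)) →
        ((C : Subset n) → IsTwinClique G X C → AtMostOneVertexIn G k p C)
        × ((Cs : List (Subset n)) → Unique Cs →
            All (λ C → IsTwinClique G X C × Meets G k p C) Cs → length Cs ≤ suc t)
        × (k ≤ 2 * t))
lemma2 G _ X cover t refl k p sp = (λ C → shortestPath-atMostOne) , λ ends-apart →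
  (λ C → endsApart⇒atMostOne ends-apart) ,
  (λ Cs uniq meets → ≤-trans (twinCliquesMet≤∣positionsOutside-X∣ uniq meets)
                              (∣positionsOutside-X∣≤1+∣X∣ (endsApart⇒noAdjacentGaps ends-apart))) ,
  length≤2*∣X∣ (endsApart⇒noAdjacentGaps ends-apart)
  where open OnShortestPath G cover sp
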